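{- Let $u=\sigma^\infty(0)$ be the fixed point starting with $0$ of the substitution $\sigma$ on $\{0,1\}$ given by $\sigma(0)=01$, $\sigma(1)=100110$. Over the alphabet $\{C,D\}$, let $\overline{\cdot}$ be the morphism exchanging $C$ and $D$, and define $T_0=C$ and $T_n=T_{n-1}T_{n-1}\overline{T_{n-1}}\,\overline{T_{n-1}}$ for $n\ge1$; let $u''=\lim_{n\to\infty}T_n$ (each $T_{n-1}$ is a prefix of $T_n$). Let $\varrho:\{C,D\}^*\to\{0,1\}^*$ be the morphism $\varrho(C)=0110$, $\varrho(D)=1001$. Then $u=\varrho(u'')$.
   Context: $\sigma^\infty(0)$ denotes the unique infinite word having all $\sigma^n(0)$ as prefixes. -}

module Defs where

open import Data.Nat using (ℕ; zero; suc; _*_)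
open import Data.Nat.DivMod using (_/_; _mod_)
open import Data.Fin using (Fin; toℕ)
open import Data.List using (List; []; _∷_; _++_; concatMap; map; length; lookup)
open import Relation.Binary.PropositionalEquality using (_≡_)

data Bit : Set where
  b0 b1 : Bit

data CD : Set where
  C D : CD

-- infinite words are functions ℕ → A; finite words are lists
-- w is a prefix of the infinite word f
IsPrefix : {A : Set} → List A → (ℕ → A) → Set
IsPrefix w f = (i : Fin (length w)) → lookup w i ≡ f (toℕ i)

σ₁ : Bit → List Bit
σ₁ b0 = b0 ∷ b1 ∷ []
σ₁ b1 = b1 ∷ b0 ∷ b0 ∷ b1 ∷ b1 ∷ b0 ∷ []

σ : List Bit → List Bit
σ = concatMap σ₁

σ^ : ℕ → List Bit → List Bit
σ^ zero w = w
σ^ (suc n) w = σ (σ^ n w)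

swap : CD → CD
swap C = D
swap D = C

bar : List CD → List CD
bar = map swap

T : ℕ → List CD
T zero = C ∷ []
T (suc n) = T n ++ T n ++ bar (T n) ++ bar (T n)

ϱ₁ : CD → List Bit
ϱ₁ C = b0 ∷ b1 ∷ b1 ∷ b0 ∷ []
ϱ₁ D = b1 ∷ b0 ∷ b0 ∷ b1 ∷ []

ϱ : List CD → List Bit
ϱ = concatMap ϱ₁

-- ϱ applied to an infinite word (ϱ is 4-uniform): letter at position i of ϱ(v)
-- is letter (i mod 4) of ϱ(v (i div 4)).
ϱ∞ : (ℕ → CD) → ℕ → Bit
ϱ∞ v i = at (v (i / 4)) (i mod 4)
  where
  at : CD → Fin 4 → Bit
  at C k = lookup (ϱ₁ C) k
  at D k = lookup (ϱ₁ D) k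

{-# OPTIONS --safe #-}
-- The morphism ϱ intertwines σ with the 4-uniform substitution τ : C ↦ CCDD, D ↦ DDCC,
-- i.e. σ ∘ ϱ = ϱ ∘ τ. Since τ commutes with the exchange, τ(T n) = T (n + 1); and since
-- σ²(0) = 01100110 = ϱ(CC), induction gives σⁿ⁺²(0) = ϱ(T n T n). So ϱ(T n) is a common
-- prefix of u and of ϱ(u''), and its length exceeds n.
module Submission where

open import Defs
open import Data.Nat using (ℕ; zero; suc; _+_; _*_; _<_; _≤_; s≤s; z≤n)
open import Data.Nat.Properties
  using (<-≤-trans; m≤m*n; m≤m+n; m≤n+m; +-mono-≤; +-monoʳ-≤; module ≤-Reasoning)
open import Data.Nat.DivMod using (_/_; _mod_; m/n≡1+[m∸n]/n)
open import Data.Fin using (Fin; toℕ; fromℕ<) renaming (zero to fz; suc to fs)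
open import Data.Fin.Properties using (toℕ-fromℕ<)
open import Data.List using (List; []; _∷_; _++_; concatMap; length; lookup)
open import Data.List.Properties using (concatMap-++; concatMap-cong; concatMap-map; map-concatMap; length-++; length-map)
open import Function using (_∘_)
open import Relation.Binary.PropositionalEquality

IsPrefix-++⁻ˡ : {A : Set} (w v : List A) {f : ℕ → A} → IsPrefix (w ++ v) f → IsPrefix w f
IsPrefix-++⁻ˡ (x ∷ w) v     p fz     = p fz
IsPrefix-++⁻ˡ (x ∷ w) v {f} p (fs k) = IsPrefix-++⁻ˡ w v {f ∘ suc} (p ∘ fs) k

IsPrefix-++⁺ : {A : Set} (w : List A) {v : List A} {f : ℕ → A} →
               IsPrefix w f → IsPrefix v (λ j → f (length w + j)) → IsPrefix (w ++ v) f
IsPrefix-++⁺ []              p q k      = q k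
IsPrefix-++⁺ (x ∷ w)         p q fz     = p fz
IsPrefix-++⁺ (x ∷ w) {f = f} p q (fs k) = IsPrefix-++⁺ w {f = f ∘ suc} (p ∘ fs) q k

IsPrefix-agree : {A : Set} (w : List A) {f g : ℕ → A} → IsPrefix w f → IsPrefix w g →
                 ∀ {i} → i < length w → f i ≡ g i
IsPrefix-agree w {f} {g} p q i<∣w∣ =
  subst (λ j → f j ≡ g j) (toℕ-fromℕ< i<∣w∣) (trans (sym (p k)) (q k))
  where k = fromℕ< i<∣w∣

concatMap-concatMap : {A B C : Set} (f : B → List C) (g : A → List B) (w : List A) →
                      concatMap f (concatMap g w) ≡ concatMap (concatMap f ∘ g) w
concatMap-concatMap f g []      = refl
concatMap-concatMap f g (x ∷ w) =
  trans (concatMap-++ f (g x) (concatMap g w)) (cong (concatMap f (g x) ++_) (concatMap-concatMap f g w))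

τ₁ : CD → List CD
τ₁ c = c ∷ c ∷ swap c ∷ swap c ∷ []

τ : List CD → List CD
τ = concatMap τ₁

σ∘ϱ≗ϱ∘τ : ∀ w → σ (ϱ w) ≡ ϱ (τ w)
σ∘ϱ≗ϱ∘τ w = begin
  σ (ϱ w)                  ≡⟨ concatMap-concatMap σ₁ ϱ₁ w ⟩
  concatMap (σ ∘ ϱ₁) w     ≡⟨ concatMap-cong σ∘ϱ₁≗ϱ∘τ₁ w ⟩
  concatMap (ϱ ∘ τ₁) w     ≡⟨ concatMap-concatMap ϱ₁ τ₁ w ⟨
  ϱ (τ w)                  ∎
  where
  open ≡-Reasoning
  σ∘ϱ₁≗ϱ∘τ₁ : ∀ c → σ (ϱ₁ c) ≡ ϱ (τ₁ c)
  σ∘ϱ₁≗ϱ∘τ₁ C = refl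
  σ∘ϱ₁≗ϱ∘τ₁ D = refl

τ∘bar≗bar∘τ : ∀ w → τ (bar w) ≡ bar (τ w)
τ∘bar≗bar∘τ w = begin
  τ (bar w)                ≡⟨ concatMap-map τ₁ swap w ⟩
  concatMap (τ₁ ∘ swap) w  ≡⟨ concatMap-cong τ₁∘swap≗bar∘τ₁ w ⟩
  concatMap (bar ∘ τ₁) w   ≡⟨ map-concatMap swap τ₁ w ⟨
  bar (τ w)                ∎
  where
  open ≡-Reasoning
  τ₁∘swap≗bar∘τ₁ : ∀ c → τ₁ (swap c) ≡ bar (τ₁ c)
  τ₁∘swap≗bar∘τ₁ C = refl
  τ₁∘swap≗bar∘τ₁ D = refl

τ-T : ∀ n → τ (T n) ≡ T (suc n)
τ-T zero    = refl
τ-T (suc n) = begin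
  τ (x ++ x ++ bar x ++ bar x)                ≡⟨ τ-++ x (x ++ bar x ++ bar x) ⟩
  τ x ++ τ (x ++ bar x ++ bar x)              ≡⟨ cong (τ x ++_) (τ-++ x (bar x ++ bar x)) ⟩
  τ x ++ τ x ++ τ (bar x ++ bar x)            ≡⟨ cong (λ y → τ x ++ τ x ++ y) (τ-++ (bar x) (bar x)) ⟩
  τ x ++ τ x ++ τ (bar x) ++ τ (bar x)        ≡⟨ cong (λ y → τ x ++ τ x ++ y ++ y) (τ∘bar≗bar∘τ x) ⟩
  τ x ++ τ x ++ bar (τ x) ++ bar (τ x)        ≡⟨ cong (λ y → y ++ y ++ bar y ++ bar y) (τ-T n) ⟩
  T (suc (suc n))                             ∎
  where
  open ≡-Reasoning
  x = T n
  τ-++ : ∀ v w → τ (v ++ w) ≡ τ v ++ τ w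
  τ-++ = concatMap-++ τ₁

σ^[2+n]0≡ϱ[TₙTₙ] : ∀ n → σ^ (2 + n) (b0 ∷ []) ≡ ϱ (T n ++ T n)
σ^[2+n]0≡ϱ[TₙTₙ] zero    = refl
σ^[2+n]0≡ϱ[TₙTₙ] (suc n) = begin
  σ (σ^ (2 + n) (b0 ∷ []))       ≡⟨ cong σ (σ^[2+n]0≡ϱ[TₙTₙ] n) ⟩
  σ (ϱ (T n ++ T n))             ≡⟨ σ∘ϱ≗ϱ∘τ (T n ++ T n) ⟩
  ϱ (τ (T n ++ T n))             ≡⟨ cong ϱ (concatMap-++ τ₁ (T n) (T n)) ⟩
  ϱ (τ (T n) ++ τ (T n))         ≡⟨ cong (λ y → ϱ (y ++ y)) (τ-T n) ⟩
  ϱ (T (suc n) ++ T (suc n))     ∎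
  where open ≡-Reasoning

-- Split on the letter so that the index type Fin (length (ϱ₁ c)) computes to Fin 4.
ϱ₁-at : CD → Fin 4 → Bit
ϱ₁-at C = lookup (ϱ₁ C)
ϱ₁-at D = lookup (ϱ₁ D)

ϱ∞-at : ∀ v i → ϱ∞ v i ≡ ϱ₁-at (v (i / 4)) (i mod 4)
ϱ∞-at v i with v (i / 4)
... | C = refl
... | D = refl

-- The remainder (4 + j) mod 4 reduces to j mod 4 by evaluation; only the quotient needs a lemma.
ϱ∞-shift : ∀ v j → ϱ∞ v (4 + j) ≡ ϱ∞ (v ∘ suc) j
ϱ∞-shift v j = begin
  ϱ∞ v (4 + j)                               ≡⟨ ϱ∞-at v (4 + j) ⟩
  ϱ₁-at (v ((4 + j) / 4)) ((4 + j) mod 4)    ≡⟨ cong (λ q → ϱ₁-at (v q) (j mod 4)) (m/n≡1+[m∸n]/n (m≤m+n 4 j)) ⟩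
  ϱ₁-at (v (suc (j / 4))) (j mod 4)          ≡⟨ ϱ∞-at (v ∘ suc) j ⟨
  ϱ∞ (v ∘ suc) j                             ∎
  where open ≡-Reasoning

ϱ∞-block₀ : ∀ {c} v → c ≡ v 0 → (k : Fin 4) → ϱ₁-at c k ≡ ϱ∞ v (toℕ k)
ϱ∞-block₀ v c≡v₀ k = trans (cong (λ d → ϱ₁-at d k) c≡v₀) (sym (ϱ∞-at₀ k))
  where
  ϱ∞-at₀ : (k : Fin 4) → ϱ∞ v (toℕ k) ≡ ϱ₁-at (v 0) k
  ϱ∞-at₀ fz                = ϱ∞-at v 0
  ϱ∞-at₀ (fs fz)           = ϱ∞-at v 1
  ϱ∞-at₀ (fs (fs fz))      = ϱ∞-at v 2
  ϱ∞-at₀ (fs (fs (fs fz))) = ϱ∞-at v 3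

ϱ₁-++-IsPrefix : ∀ c {w v} → c ≡ v 0 → IsPrefix w (ϱ∞ (v ∘ suc)) → IsPrefix (ϱ₁ c ++ w) (ϱ∞ v)
ϱ₁-++-IsPrefix C {v = v} c≡v₀ p =
  IsPrefix-++⁺ (ϱ₁ C) {f = ϱ∞ v} (ϱ∞-block₀ v c≡v₀) (λ k → trans (p k) (sym (ϱ∞-shift v (toℕ k))))
ϱ₁-++-IsPrefix D {v = v} c≡v₀ p =
  IsPrefix-++⁺ (ϱ₁ D) {f = ϱ∞ v} (ϱ∞-block₀ v c≡v₀) (λ k → trans (p k) (sym (ϱ∞-shift v (toℕ k))))

ϱ-IsPrefix : ∀ w {v} → IsPrefix w v → IsPrefix (ϱ w) (ϱ∞ v)
ϱ-IsPrefix []      p ()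
ϱ-IsPrefix (c ∷ w) {v} p = ϱ₁-++-IsPrefix c {v = v} (p fz) (ϱ-IsPrefix w {v ∘ suc} (p ∘ fs))

length-ϱ : ∀ w → length (ϱ w) ≡ length w * 4
length-ϱ []      = refl
length-ϱ (C ∷ w) = cong (4 +_) (length-ϱ w)
length-ϱ (D ∷ w) = cong (4 +_) (length-ϱ w)

length-T-suc : ∀ n → let ℓ = length (T n) in length (T (suc n)) ≡ ℓ + (ℓ + (ℓ + ℓ))
length-T-suc n = begin
  length (x ++ x ++ bar x ++ bar x)                              ≡⟨ length-++ x ⟩
  ℓ + length (x ++ bar x ++ bar x)                               ≡⟨ cong (ℓ +_) (length-++ x) ⟩
  ℓ + (ℓ + length (bar x ++ bar x))                              ≡⟨ cong (λ m → ℓ + (ℓ + m)) (length-++ (bar x)) ⟩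
  ℓ + (ℓ + (length (bar x) + length (bar x)))                    ≡⟨ cong (λ m → ℓ + (ℓ + (m + m))) (length-map swap x) ⟩
  ℓ + (ℓ + (ℓ + ℓ))                                              ∎
  where
  open ≡-Reasoning
  x = T n
  ℓ = length x

n<length-T : ∀ n → n < length (T n)
n<length-T zero    = s≤s z≤n
n<length-T (suc n) = begin-strict
  suc n                 <⟨ s≤s (m≤n+m (suc n) n) ⟩
  suc n + suc n         ≤⟨ +-mono-≤ (n<length-T n) (n<length-T n) ⟩
  ℓ + ℓ                 ≤⟨ +-monoʳ-≤ ℓ (m≤m+n ℓ (ℓ + ℓ)) ⟩
  ℓ + (ℓ + (ℓ + ℓ))     ≡⟨ length-T-suc n ⟨
  length (T (suc n))    ∎
  where
  open ≤-Reasoning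
  ℓ = length (T n)

lemma6p5 : (u : ℕ → Bit) (u'' : ℕ → CD)
    → (∀ n → IsPrefix (σ^ n (b0 ∷ [])) u)
    → (∀ n → IsPrefix (T n) u'')
    → ∀ i → u i ≡ ϱ∞ u'' i
lemma6p5 u u'' u-prefixes u''-prefixes i =
  IsPrefix-agree (ϱ (T i)) {u} {ϱ∞ u''} ϱTᵢ-prefix-of-u (ϱ-IsPrefix (T i) {u''} (u''-prefixes i)) i<∣ϱTᵢ∣
  where
  ϱTᵢ-prefix-of-u : IsPrefix (ϱ (T i)) u
  ϱTᵢ-prefix-of-u = IsPrefix-++⁻ˡ (ϱ (T i)) (ϱ (T i)) {u}
    (subst (λ w → IsPrefix w u) (trans (σ^[2+n]0≡ϱ[TₙTₙ] i) (concatMap-++ ϱ₁ (T i) (T i))) (u-prefixes (2 + i)))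
  i<∣ϱTᵢ∣ : i < length (ϱ (T i))
  i<∣ϱTᵢ∣ = <-≤-trans (n<length-T i) (subst (length (T i) ≤_) (sym (length-ϱ (T i))) (m≤m*n (length (T i)) 4))
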